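{- Let $n,\delta\in\mathbb{N}$ with $\delta\geq 3$ and $n\geq 6$. If $G$ is a connected $C_4$-free graph of order $n$ and minimum degree $\delta$, then \[\rho(G)-\pi(G)\leq \frac{5(n+1)}{4\left(\delta^2-2\lfloor\frac{\delta}{2}\rfloor +1\right)}+\frac{101}{20}.\]
   Context: All graphs are finite and simple. For a connected graph $G$ of order $n\ge 2$ and a vertex $v$, the average distance of $v$ is $\overline{\sigma}(v)=\frac{1}{n-1}\sum_{w\in V(G)}d(v,w)$, where $d$ is the shortest-path distance. The proximity is $\pi(G)=\min_{v}\overline{\sigma}(v)$ and the remoteness is $\rho(G)=\max_{v}\overline{\sigma}(v)$. A graph is $C_4$-free if it does not contain a $4$-cycle as a (not necessarily induced) subgraph. -}

module Defs where

open import Data.Nat as ℕ using (ℕ; zero; suc; _+_; _*_; _∸_; _≤_; _⊔_; _⊓_)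
open import Data.Nat.DivMod using (_/_)
open import Data.Fin using (Fin; zero; suc)
open import Data.Bool using (Bool; true; false; T)
open import Data.List using (List; []; _∷_; map; foldr; allFin; filter; length)
open import Data.Nat.ListAction using (sum)
open import Data.Product using (Σ; ∃; _×_; _,_)
open import Relation.Binary.PropositionalEquality using (_≡_; _≢_)
open import Relation.Nullary using (¬_)
open import Data.Integer using (+_)
import Data.Rational as ℚ

record Graph (n : ℕ) : Set where
  field
    adj     : Fin n → Fin n → Bool
    sym     : ∀ u v → adj u v ≡ adj v u
    irrefl  : ∀ v → adj v v ≡ false
open Graph public

Adj : ∀ {n} → Graph n → Fin n → Fin n → Set
Adj G u v = T (adj G u v)

data Walk {n} (G : Graph n) : Fin n → Fin n → ℕ → Set where
  here : ∀ {v} → Walk G v v 0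
  step : ∀ {u w v k} → Adj G u w → Walk G w v k → Walk G u v (suc k)

Connected : ∀ {n} → Graph n → Set
Connected G = ∀ u v → ∃ λ k → Walk G u v k

IsDistance : ∀ {n} → Graph n → (Fin n → Fin n → ℕ) → Set
IsDistance G d = ∀ u v → Walk G u v (d u v) × (∀ k → Walk G u v k → d u v ≤ k)

degree : ∀ {n} → Graph n → Fin n → ℕ
degree {n} G v = length (filter (λ w → Data.Bool._≟_ (adj G v w) true) (allFin n))

MinDegree : ∀ {n} → Graph n → ℕ → Set
MinDegree G δ = (∀ v → δ ≤ degree G v) × (∃ λ v → degree G v ≡ δ)

C4Free : ∀ {n} → Graph n → Set
C4Free G = ∀ a b c e → a ≢ b → a ≢ c → a ≢ e → b ≢ c → b ≢ e → c ≢ e →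
  ¬ (Adj G a b × Adj G b c × Adj G c e × Adj G e a)

transmission : ∀ {n} → (Fin n → Fin n → ℕ) → Fin n → ℕ
transmission {n} d v = sum (map (d v) (allFin n))

maxTrans minTrans : ∀ {n} → (Fin n → Fin n → ℕ) → ℕ
maxTrans {zero}  d = 0
maxTrans {suc n} d = foldr _⊔_ 0 (map (transmission d) (allFin (suc n)))
minTrans {zero}  d = 0
minTrans {suc n} d = foldr _⊓_ (transmission d zero) (map (transmission d) (allFin (suc n)))

-- division by (n - 1) as a rational (only meaningful for n ≥ 2)
divByPred : ℕ → ℕ → ℚ.ℚ
divByPred zero          s = ℚ.0ℚ
divByPred (suc zero)    s = ℚ.0ℚ
divByPred (suc (suc k)) s = (+ s) ℚ./ suc k

remoteness proximity : ∀ {n} → (Fin n → Fin n → ℕ) → ℚ.ℚ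
remoteness {n} d = divByPred n (maxTrans d)
proximity  {n} d = divByPred n (minTrans d)

-- the bound 5(n+1) / (4(δ² - 2⌊δ/2⌋ + 1)) + 101/20
-- (δ² - 2⌊δ/2⌋ ≥ 0 always, so the truncated subtraction is exact)
bound : ℕ → ℕ → ℚ.ℚ
bound n δ = (+ (5 * (n + 1))) ℚ./ (4 * suc (δ * δ ∸ 2 * (δ / 2)))
            ℚ.+ (+ 101) ℚ./ 20

-- Let v and u be vertices of maximum and minimum transmission and k = d(v, u). In a C₄-free graph of
-- minimum degree δ ≥ 2 every ball of radius 2 has at least D = δ² − 2⌊δ/2⌋ + 1 vertices: the
-- neighbours of x span a matching, and distinct neighbours of x have disjoint neighbourhoods outside
-- N[x]. Balls centred on a geodesic from v then show that at least D(K − 2)/5 vertices lie at distance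
-- less than K from v whenever K ≤ k. Since d(v, w) + 2 (k − d(v, w))⁺ ≤ k + d(u, w) for every w,
-- σ(v) − σ(u) ≤ n k − D k (k − 3)/5, and maximising over k gives 20 D (σ(v) − σ(u)) ≤ (5n + 3D)²,
-- which for D ≤ n and n ≥ 6 is at most the stated bound times 20 D (n − 1).

module Submission where

open import Defs hiding (sym)
open import Data.Nat using (ℕ; _≤_)
open import Data.Fin using (Fin)
import Data.Rational as ℚ

open import Data.Nat using (zero; suc; _+_; _*_; _∸_; _/_; _<_; z≤n; s≤s; s≤s⁻¹; _⊔_; _⊓_; _<?_)
open import Data.Nat.Properties hiding (_≟_)
open import Data.Nat.Divisibility using (_∣_; divides; ∣m∣n⇒∣m+n; m∣m*n)
open import Data.Nat.DivMod using (/-monoˡ-≤; m*n/n≡m; m≥n⇒m/n>0)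
open import Data.Nat.Tactic.RingSolver using (solve-∀)
import Data.Nat.ListAction as List
open import Data.Fin using (zero; suc; _≟_)
import Data.Fin.Properties as Fin
open import Data.Bool using (true; false; T)
import Data.Bool as Bool
open import Data.List using ([]; _∷_; map; foldr; allFin; filter; length; tabulate)
open import Data.List.Properties using (map-tabulate)
open import Data.Product using (∃; _×_; _,_; proj₁; proj₂)
open import Data.Sum using (inj₁; inj₂)
open import Relation.Binary.PropositionalEquality
open import Relation.Nullary using (¬_; Dec; yes; no; T?; contradiction)
open import Data.Integer as ℤ using (ℤ)
import Data.Integer.Properties as ℤP
import Data.Integer.Tactic.RingSolver as ℤSolver
import Data.Rational.Properties as ℚ
open import Data.Rational.Unnormalised as ℚᵘ using (mkℚᵘ)
import Data.Rational.Unnormalised.Properties as ℚᵘ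
open import Algebra.Properties.Semiring.Sum +-*-semiring
  using (sum; sum-syntax; ∑-distrib-+; ∑-comm; *-distribˡ-sum; *-distribʳ-sum; sum-cong-≗)

𝟙[_] : ∀ {p} {P : Set p} → Dec P → ℕ
𝟙[ yes _ ] = 1
𝟙[ no _ ] = 0

module _ {p} {P : Set p} where

  𝟙[]≤1 : (P? : Dec P) → 𝟙[ P? ] ≤ 1
  𝟙[]≤1 (yes _) = ≤-refl
  𝟙[]≤1 (no _) = z≤n

  𝟙[]-yes : (P? : Dec P) → P → 𝟙[ P? ] ≡ 1
  𝟙[]-yes (yes _) _ = refl
  𝟙[]-yes (no ¬p) p = contradiction p ¬p

  𝟙[]-no : (P? : Dec P) → ¬ P → 𝟙[ P? ] ≡ 0
  𝟙[]-no (yes p) ¬p = contradiction p ¬p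
  𝟙[]-no (no _) _ = refl

  𝟙[]-witness : (P? : Dec P) → 1 ≤ 𝟙[ P? ] → P
  𝟙[]-witness (yes p) _ = p

  ≤𝟙[] : ∀ {m} (P? : Dec P) → m ≤ 1 → (1 ≤ m → P) → m ≤ 𝟙[ P? ]
  ≤𝟙[] (yes _) m≤1 _ = m≤1
  ≤𝟙[] {m = zero} (no _) _ _ = z≤n
  ≤𝟙[] {m = suc _} (no ¬p) _ pos = contradiction (pos (s≤s z≤n)) ¬p

𝟙[]*𝟙[]-witness : ∀ {p q} {P : Set p} {Q : Set q} (P? : Dec P) (Q? : Dec Q) →
  1 ≤ 𝟙[ P? ] * 𝟙[ Q? ] → P × Q
𝟙[]*𝟙[]-witness (yes p) (yes q) _ = p , q

length-filter≡sum : ∀ {a p} {A : Set a} {P : A → Set p} (P? : ∀ x → Dec (P x)) xs →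
  length (filter P? xs) ≡ List.sum (map (λ x → 𝟙[ P? x ]) xs)
length-filter≡sum P? [] = refl
length-filter≡sum P? (x ∷ xs) with P? x
... | yes _ = cong suc (length-filter≡sum P? xs)
... | no _ = length-filter≡sum P? xs

List-sum-allFin : ∀ {n} (f : Fin n → ℕ) → List.sum (map f (allFin n)) ≡ ∑[ i < n ] f i
List-sum-allFin {n} f = trans (cong List.sum (map-tabulate (λ i → i) f)) (sum-tabulate f)
  where
  sum-tabulate : ∀ {n} (f : Fin n → ℕ) → List.sum (tabulate f) ≡ ∑[ i < n ] f i
  sum-tabulate {zero} f = refl
  sum-tabulate {suc n} f = cong (f zero +_) (sum-tabulate (λ i → f (suc i)))

∑-mono-≤ : ∀ {n} {f g : Fin n → ℕ} → (∀ i → f i ≤ g i) → sum f ≤ sum g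
∑-mono-≤ {zero} f≤g = z≤n
∑-mono-≤ {suc n} f≤g = +-mono-≤ (f≤g zero) (∑-mono-≤ (λ i → f≤g (suc i)))

∑-const : ∀ n c → ∑[ i < n ] c ≡ n * c
∑-const zero c = refl
∑-const (suc n) c = cong (c +_) (∑-const n c)

∑-≤-card : ∀ {n} {f : Fin n → ℕ} → (∀ i → f i ≤ 1) → sum f ≤ n
∑-≤-card {n} f≤1 = ≤-trans (∑-mono-≤ f≤1) (≤-reflexive (trans (∑-const n 1) (*-identityʳ n)))

term≤∑ : ∀ {n} (f : Fin n → ℕ) i → f i ≤ sum f
term≤∑ f zero = m≤m+n _ _
term≤∑ f (suc i) = ≤-trans (term≤∑ (λ j → f (suc j)) i) (m≤n+m _ (f zero))

∑-positive : ∀ {n} (f : Fin n → ℕ) → 1 ≤ sum f → ∃ λ i → 1 ≤ f i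
∑-positive {suc n} f 1≤∑ with f zero in eq
... | suc _ = zero , subst (1 ≤_) (sym eq) (s≤s z≤n)
... | zero with ∑-positive (λ i → f (suc i)) 1≤∑
...   | i , 1≤fi = suc i , 1≤fi

∑-vanishes : ∀ {n} (f : Fin n → ℕ) → (∀ i → ¬ 1 ≤ f i) → sum f ≡ 0
∑-vanishes f f≡0 with sum f in eq
... | zero = refl
... | suc _ = contradiction (proj₂ (∑-positive f (subst (1 ≤_) (sym eq) (s≤s z≤n)))) (f≡0 _)

∑-≤1 : ∀ {n} (f : Fin n → ℕ) → (∀ i → f i ≤ 1) →
  (∀ i j → 1 ≤ f i → 1 ≤ f j → i ≡ j) → sum f ≤ 1
∑-≤1 {zero} f f≤1 unique = z≤n
∑-≤1 {suc n} f f≤1 unique with f zero in eq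
... | zero = ∑-≤1 (λ i → f (suc i)) (λ i → f≤1 (suc i))
               (λ i j p q → Fin.suc-injective (unique (suc i) (suc j) p q))
... | suc k = ≤-trans (≤-reflexive (trans (cong (suc k +_) rest≡0) (+-identityʳ _)))
                      (subst (_≤ 1) eq (f≤1 zero))
  where
  rest≡0 : ∑[ i < n ] f (suc i) ≡ 0
  rest≡0 = ∑-vanishes (λ i → f (suc i))
             (λ i p → Fin.0≢1+n (unique zero (suc i) (subst (1 ≤_) (sym eq) (s≤s z≤n)) p))

∑∑-symmetric-even : ∀ {n} (f : Fin n → Fin n → ℕ) → (∀ i j → f i j ≡ f j i) → (∀ i → f i i ≡ 0) →
  2 ∣ ∑[ i < n ] ∑[ j < n ] f i j
∑∑-symmetric-even {zero} f symm diag = divides 0 refl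
∑∑-symmetric-even {suc n} f symm diag = subst (2 ∣_) (sym split) (∣m∣n⇒∣m+n (m∣m*n a) inner)
  where
  a = ∑[ j < n ] f zero (suc j)
  inner = ∑∑-symmetric-even (λ i j → f (suc i) (suc j)) (λ i j → symm (suc i) (suc j)) (λ i → diag (suc i))
  c = ∑[ i < n ] ∑[ j < n ] f (suc i) (suc j)
  split : ∑[ i < suc n ] ∑[ j < suc n ] f i j ≡ 2 * a + c
  split = begin
    f zero zero + a + ∑[ i < n ] (f (suc i) zero + ∑[ j < n ] f (suc i) (suc j))
      ≡⟨ cong₂ (λ x y → x + a + y) (diag zero) (∑-distrib-+ (λ i → f (suc i) zero) _) ⟩
    a + (∑[ i < n ] f (suc i) zero + c)
      ≡⟨ cong (λ b → a + (b + c)) (sum-cong-≗ (λ i → symm (suc i) zero)) ⟩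
    a + (a + c)
      ≡⟨ sym (+-assoc a a c) ⟩
    a + a + c
      ≡⟨ cong (λ b → a + b + c) (sym (+-identityʳ a)) ⟩
    2 * a + c ∎
    where open ≡-Reasoning

module Walks {n} (G : Graph n) where

  Adj-sym : ∀ {u v} → Adj G u v → Adj G v u
  Adj-sym {u} {v} = subst T (Graph.sym G u v)

  Adj⇒≢ : ∀ {u v} → Adj G u v → u ≢ v
  Adj⇒≢ {u} uv refl = subst T (irrefl G u) uv

  walk-++ : ∀ {a b c k l} → Walk G a b k → Walk G b c l → Walk G a c (k + l)
  walk-++ here q = q
  walk-++ (step ab p) q = step ab (walk-++ p q)

  walk-reverse : ∀ {a b k} → Walk G a b k → Walk G b a k
  walk-reverse here = here
  walk-reverse {k = suc k} (step ab p) =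
    subst (Walk G _ _) (+-comm k 1) (walk-++ (walk-reverse p) (step (Adj-sym ab) here))

  walk-split : ∀ {a b k} j → j ≤ k → Walk G a b k → ∃ λ x → Walk G a x j × Walk G x b (k ∸ j)
  walk-split zero _ p = _ , here , p
  walk-split (suc j) (s≤s j≤k) (step ab p) with walk-split j j≤k p
  ... | x , p₁ , p₂ = x , step ab p₁ , p₂

module Distance {n} (G : Graph n) (d : Fin n → Fin n → ℕ) (isD : IsDistance G d) where
  open Walks G

  geodesic : ∀ u v → Walk G u v (d u v)
  geodesic u v = proj₁ (isD u v)

  d-minimal : ∀ {u v k} → Walk G u v k → d u v ≤ k
  d-minimal {u} {v} {k} = proj₂ (isD u v) k

  d-triangle : ∀ a b c → d a c ≤ d a b + d b c
  d-triangle a b c = d-minimal (walk-++ (geodesic a b) (geodesic b c))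

  d-sym : ∀ a b → d a b ≡ d b a
  d-sym a b = ≤-antisym (d-minimal (walk-reverse (geodesic b a)))
                        (d-minimal (walk-reverse (geodesic a b)))

  d-refl : ∀ a → d a a ≡ 0
  d-refl a = n≤0⇒n≡0 (d-minimal here)

  d-adj : ∀ {a b} → Adj G a b → d a b ≤ 1
  d-adj ab = d-minimal (step ab here)

  d-adj² : ∀ {a b c} → Adj G a b → Adj G b c → d a c ≤ 2
  d-adj² ab bc = d-minimal (step ab (step bc here))

  d-intermediate : ∀ v u j → j ≤ d v u → ∃ λ x → d v x ≡ j
  d-intermediate v u j j≤k with walk-split j j≤k (geodesic v u)
  ... | x , p₁ , p₂ = x , ≤-antisym (d-minimal p₁) j≤dvx
    where
    j≤dvx : j ≤ d v x
    j≤dvx = +-cancelʳ-≤ (d v u ∸ j) j (d v x) (begin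
      j + (d v u ∸ j)       ≡⟨ m+[n∸m]≡n j≤k ⟩
      d v u                 ≤⟨ d-triangle v x u ⟩
      d v x + d x u         ≤⟨ +-monoʳ-≤ (d v x) (d-minimal p₂) ⟩
      d v x + (d v u ∸ j)   ∎)
      where open ≤-Reasoning

even≤⇒≤2*[/2] : ∀ {m n} → 2 ∣ m → m ≤ n → m ≤ 2 * (n / 2)
even≤⇒≤2*[/2] {m} {n} (divides q refl) q*2≤n = subst (_≤ 2 * (n / 2)) (*-comm 2 q)
  (*-monoʳ-≤ 2 (subst (_≤ n / 2) (m*n/n≡m q 2) (/-monoˡ-≤ 2 q*2≤n)))

ball-bound : ℕ → ℕ
ball-bound δ = suc (δ * δ ∸ 2 * (δ / 2))

-- Here e = deg x, M is twice the number of edges inside N(x) and O the number of vertices at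
-- distance 2 from x. The case e = δ uses the parity of M, the case e > δ the slack e (δ − 1) ≥ δ² − 1.
ball-arith : ∀ δ e O M → 2 ≤ δ → δ ≤ e → M ≤ e → 2 ∣ M → e * δ ≤ O + e + M →
  δ * δ ∸ 2 * (δ / 2) ≤ e + O
ball-arith δ e O M 2≤δ δ≤e M≤e 2∣M eδ≤ with m≤n⇒m<n∨m≡n δ≤e
... | inj₂ refl = m≤n+o⇒m∸n≤o (δ * δ) (2 * (δ / 2)) (begin
  δ * δ                   ≤⟨ eδ≤ ⟩
  O + δ + M               ≤⟨ +-monoʳ-≤ (O + δ) (even≤⇒≤2*[/2] 2∣M M≤e) ⟩
  O + δ + 2 * (δ / 2)     ≡⟨ +-comm (O + δ) _ ⟩
  2 * (δ / 2) + (O + δ)   ≡⟨ cong (2 * (δ / 2) +_) (+-comm O δ) ⟩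
  2 * (δ / 2) + (δ + O)   ∎)
  where open ≤-Reasoning
ball-arith δ@(suc δ′) e O M 2≤δ δ≤e M≤e 2∣M eδ≤ | inj₁ δ<e = m≤n+o⇒m∸n≤o (δ * δ) (2 * (δ / 2)) (begin
  δ * δ                   ≡⟨ square-suc δ′ ⟩
  1 + suc δ * δ′          ≤⟨ +-monoʳ-≤ 1 (*-monoˡ-≤ δ′ δ<e) ⟩
  1 + e * δ′              ≤⟨ +-monoʳ-≤ 1 eδ′≤ ⟩
  1 + (O + e)             ≤⟨ +-monoˡ-≤ (O + e) (≤-trans (m≥n⇒m/n>0 2≤δ) (m≤n*m (δ / 2) 2)) ⟩
  2 * (δ / 2) + (O + e)   ≡⟨ cong (2 * (δ / 2) +_) (+-comm O e) ⟩
  2 * (δ / 2) + (e + O)   ∎)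
  where
  open ≤-Reasoning
  square-suc : ∀ m → suc m * suc m ≡ 1 + suc (suc m) * m
  square-suc = solve-∀
  eδ′≤ : e * δ′ ≤ O + e
  eδ′≤ = +-cancelˡ-≤ e _ _ (begin
    e + e * δ′     ≡⟨ *-suc e δ′ ⟨
    e * δ          ≤⟨ eδ≤ ⟩
    O + e + M      ≤⟨ +-monoʳ-≤ (O + e) M≤e ⟩
    O + e + e      ≡⟨ +-comm (O + e) e ⟩
    e + (O + e)    ∎)

module Ball {n} (G : Graph n) (d : Fin n → Fin n → ℕ) (isD : IsDistance G d) (c4 : C4Free G) where
  open Walks G
  open Distance G d isD

  A : Fin n → Fin n → ℕ
  A x y = 𝟙[ T? (adj G x y) ]

  A≤1 : ∀ x y → A x y ≤ 1
  A≤1 x y = 𝟙[]≤1 (T? (adj G x y))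

  A-sym : ∀ x y → A x y ≡ A y x
  A-sym x y = cong (λ b → 𝟙[ T? b ]) (Graph.sym G x y)

  A-irrefl : ∀ x → A x x ≡ 0
  A-irrefl x = cong (λ b → 𝟙[ T? b ]) (irrefl G x)

  A-adj : ∀ {x w} → Adj G x w → A x w ≡ 1
  A-adj {x} {w} = 𝟙[]-yes (T? (adj G x w))

  A-nonadj : ∀ {x w} → ¬ Adj G x w → A x w ≡ 0
  A-nonadj {x} {w} = 𝟙[]-no (T? (adj G x w))

  data Position (x w : Fin n) : Set where
    centre : x ≡ w → Position x w
    neighbour : Adj G x w → Position x w
    far : x ≢ w → ¬ Adj G x w → Position x w

  position : ∀ x w → Position x w
  position x w with x ≟ w | T? (adj G x w)
  ... | yes x≡w | _ = centre x≡w
  ... | no _ | yes xw = neighbour xw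
  ... | no x≢w | no ¬xw = far x≢w ¬xw

  deg : Fin n → ℕ
  deg x = ∑[ y < n ] A x y

  degree≡deg : ∀ x → degree G x ≡ deg x
  degree≡deg x = trans (length-filter≡sum _ (allFin n))
    (trans (List-sum-allFin (λ y → 𝟙[ adj G x y Bool.≟ true ]))
           (sum-cong-≗ (λ y → 𝟙[≟true]≡𝟙[T?] (adj G x y))))
    where
    𝟙[≟true]≡𝟙[T?] : ∀ b → 𝟙[ b Bool.≟ true ] ≡ 𝟙[ T? b ]
    𝟙[≟true]≡𝟙[T?] true = refl
    𝟙[≟true]≡𝟙[T?] false = refl

  common : Fin n → Fin n → ℕ
  common x z = ∑[ y < n ] (A x y * A y z)

  path₂ : ∀ {x y z} → 1 ≤ A x y * A y z → Adj G x y × Adj G y z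
  path₂ {x} {y} {z} = 𝟙[]*𝟙[]-witness (T? (adj G x y)) (T? (adj G y z))

  common-neighbour-unique : ∀ {x z y₁ y₂} → x ≢ z →
    Adj G x y₁ → Adj G y₁ z → Adj G x y₂ → Adj G y₂ z → y₁ ≡ y₂
  common-neighbour-unique {x} {z} {y₁} {y₂} x≢z xy₁ y₁z xy₂ y₂z with y₁ ≟ y₂
  ... | yes y₁≡y₂ = y₁≡y₂
  ... | no y₁≢y₂ = contradiction (xy₁ , y₁z , Adj-sym y₂z , Adj-sym xy₂)
    (c4 x y₁ z y₂ (Adj⇒≢ xy₁) x≢z (Adj⇒≢ xy₂) (Adj⇒≢ y₁z) y₁≢y₂ (Adj⇒≢ (Adj-sym y₂z)))

  common≤1 : ∀ {x z} → x ≢ z → common x z ≤ 1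
  common≤1 {x} {z} x≢z = ∑-≤1 _ (λ y → *-mono-≤ (A≤1 x y) (A≤1 y z)) unique
    where
    unique : ∀ y₁ y₂ → 1 ≤ A x y₁ * A y₁ z → 1 ≤ A x y₂ * A y₂ z → y₁ ≡ y₂
    unique y₁ y₂ p₁ p₂ with path₂ p₁ | path₂ p₂
    ... | xy₁ , y₁z | xy₂ , y₂z = common-neighbour-unique x≢z xy₁ y₁z xy₂ y₂z

  common≤𝟙[d<3] : ∀ {x z} → x ≢ z → common x z ≤ 𝟙[ d x z <? 3 ]
  common≤𝟙[d<3] {x} {z} x≢z = ≤𝟙[] (d x z <? 3) (common≤1 x≢z) within-2
    where
    within-2 : 1 ≤ common x z → d x z < 3
    within-2 pos with ∑-positive (λ y → A x y * A y z) pos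
    ... | y , p = s≤s (d-adj² (proj₁ (path₂ p)) (proj₂ (path₂ p)))

  closed : Fin n → Fin n → ℕ
  closed x w = 𝟙[ x ≟ w ] + A x w

  -- Phrased through common neighbours so that its sum over w can be evaluated by double counting.
  ball₂ : Fin n → Fin n → ℕ
  ball₂ x w = closed x w + common x w * (1 ∸ closed x w)

  closed-self : ∀ x → closed x x ≡ 1
  closed-self x = cong₂ _+_ (𝟙[]-yes (x ≟ x) refl) (A-irrefl x)

  closed-adj : ∀ {x w} → Adj G x w → closed x w ≡ 1
  closed-adj {x} {w} xw = cong₂ _+_ (𝟙[]-no (x ≟ w) (Adj⇒≢ xw)) (A-adj xw)

  closed-far : ∀ {x w} → x ≢ w → ¬ Adj G x w → closed x w ≡ 0
  closed-far {x} {w} x≢w ¬xw = cong₂ _+_ (𝟙[]-no (x ≟ w) x≢w) (A-nonadj ¬xw)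

  ball₂-closed : ∀ {x w} → closed x w ≡ 1 → ball₂ x w ≡ 1
  ball₂-closed {x} {w} e =
    trans (cong (λ c → c + common x w * (1 ∸ c)) e) (cong suc (*-zeroʳ (common x w)))

  ball₂-far : ∀ {x w} → closed x w ≡ 0 → ball₂ x w ≡ common x w
  ball₂-far {x} {w} e =
    trans (cong (λ c → c + common x w * (1 ∸ c)) e) (*-identityʳ (common x w))

  ball₂≤𝟙[d<3] : ∀ x w → ball₂ x w ≤ 𝟙[ d x w <? 3 ]
  ball₂≤𝟙[d<3] x w with position x w
  ... | centre refl = ≤𝟙[] (d x x <? 3) (≤-reflexive (ball₂-closed (closed-self x)))
                        (λ _ → subst (_< 3) (sym (d-refl x)) (s≤s z≤n))
  ... | neighbour xw = ≤𝟙[] (d x w <? 3) (≤-reflexive (ball₂-closed (closed-adj xw)))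
                        (λ _ → s≤s (≤-trans (d-adj xw) (s≤s z≤n)))
  ... | far x≢w ¬xw = subst (_≤ 𝟙[ d x w <? 3 ]) (sym (ball₂-far (closed-far x≢w ¬xw)))
                        (common≤𝟙[d<3] x≢w)

  ∑𝟙[≟]≡1 : ∀ x → ∑[ w < n ] 𝟙[ x ≟ w ] ≡ 1
  ∑𝟙[≟]≡1 x = ≤-antisym (∑-≤1 _ (λ w → 𝟙[]≤1 (x ≟ w)) at-x)
                        (subst (_≤ ∑[ w < n ] 𝟙[ x ≟ w ]) (𝟙[]-yes (x ≟ x) refl) (term≤∑ _ x))
    where
    at-x : ∀ i j → 1 ≤ 𝟙[ x ≟ i ] → 1 ≤ 𝟙[ x ≟ j ] → i ≡ j
    at-x i j x≡i x≡j = trans (sym (𝟙[]-witness (x ≟ i) x≡i)) (𝟙[]-witness (x ≟ j) x≡j)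

  escape : Fin n → Fin n → ℕ
  escape x y = ∑[ w < n ] (A y w * (1 ∸ closed x w))

  outer : Fin n → ℕ
  outer x = ∑[ y < n ] (A x y * escape x y)

  -- Double counting the paths x – y – w with w ∉ N[x].
  ∑ball₂ : ∀ x → ∑[ w < n ] ball₂ x w ≡ 1 + deg x + outer x
  ∑ball₂ x = begin
    ∑[ w < n ] (closed x w + common x w * out w)
      ≡⟨ ∑-distrib-+ (closed x) _ ⟩
    ∑[ w < n ] closed x w + ∑[ w < n ] (common x w * out w)
      ≡⟨ cong₂ _+_ (trans (∑-distrib-+ _ (A x)) (cong (_+ deg x) (∑𝟙[≟]≡1 x))) double-count ⟩
    1 + deg x + outer x ∎
    where
    open ≡-Reasoning
    out : Fin n → ℕ
    out w = 1 ∸ closed x w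
    double-count : ∑[ w < n ] (common x w * out w) ≡ outer x
    double-count = begin
      ∑[ w < n ] (common x w * out w)
        ≡⟨ sum-cong-≗ (λ w → *-distribʳ-sum (out w) (λ y → A x y * A y w)) ⟩
      ∑[ w < n ] ∑[ y < n ] (A x y * A y w * out w)
        ≡⟨ ∑-comm (λ w y → A x y * A y w * out w) ⟩
      ∑[ y < n ] ∑[ w < n ] (A x y * A y w * out w)
        ≡⟨ sum-cong-≗ (λ y → trans (sum-cong-≗ (λ w → *-assoc (A x y) (A y w) (out w)))
                                   (sym (*-distribˡ-sum (A x y) (λ w → A y w * out w)))) ⟩
      outer x ∎

  deg≤escape+1+common : ∀ x y → deg y ≤ escape x y + 1 + common x y
  deg≤escape+1+common x y = begin
    ∑[ w < n ] A y w
      ≤⟨ ∑-mono-≤ split ⟩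
    ∑[ w < n ] (A y w * (1 ∸ closed x w) + 𝟙[ x ≟ w ] + A x w * A w y)
      ≡⟨ ∑-distrib-+ (λ w → A y w * (1 ∸ closed x w) + 𝟙[ x ≟ w ]) _ ⟩
    ∑[ w < n ] (A y w * (1 ∸ closed x w) + 𝟙[ x ≟ w ]) + common x y
      ≡⟨ cong (_+ common x y) (trans (∑-distrib-+ (λ w → A y w * (1 ∸ closed x w)) (λ w → 𝟙[ x ≟ w ]))
                                     (cong (escape x y +_) (∑𝟙[≟]≡1 x))) ⟩
    escape x y + 1 + common x y ∎
    where
    open ≤-Reasoning
    split : ∀ w → A y w ≤ A y w * (1 ∸ closed x w) + 𝟙[ x ≟ w ] + A x w * A w y
    split w with position x w
    ... | centre refl = ≤-trans (A≤1 y x) (≤-trans (≤-reflexive (sym (𝟙[]-yes (x ≟ x) refl)))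
                                          (≤-trans (m≤n+m _ (A y x * (1 ∸ closed x x))) (m≤m+n _ _)))
    ... | neighbour xw = ≤-trans (≤-reflexive via-x) (m≤n+m _ _)
      where
      via-x : A y w ≡ A x w * A w y
      via-x = trans (A-sym y w) (sym (trans (cong (_* A w y) (A-adj xw)) (*-identityˡ _)))
    ... | far x≢w ¬xw = ≤-trans (≤-reflexive stays) (≤-trans (m≤m+n _ _) (m≤m+n _ _))
      where
      stays : A y w ≡ A y w * (1 ∸ closed x w)
      stays = sym (trans (cong (λ c → A y w * (1 ∸ c)) (closed-far x≢w ¬xw)) (*-identityʳ _))

  -- twice the number of edges inside N(x)
  inner : Fin n → ℕ
  inner x = ∑[ y < n ] (A x y * common x y)

  inner≤deg : ∀ x → inner x ≤ deg x
  inner≤deg x = ∑-mono-≤ bounded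
    where
    bounded : ∀ y → A x y * common x y ≤ A x y
    bounded y with position x y
    ... | centre refl = subst (λ a → a * common x x ≤ a) (sym (A-irrefl x)) z≤n
    ... | neighbour xy = subst (A x y * common x y ≤_) (*-identityʳ (A x y))
                               (*-monoʳ-≤ (A x y) (common≤1 (Adj⇒≢ xy)))
    ... | far _ ¬xy = subst (λ a → a * common x y ≤ a) (sym (A-nonadj ¬xy)) z≤n

  inner-even : ∀ x → 2 ∣ inner x
  inner-even x = subst (2 ∣_) (sym (sum-cong-≗ (λ y → *-distribˡ-sum (A x y) (λ w → A x w * A w y))))
    (∑∑-symmetric-even (λ y w → A x y * (A x w * A w y)) symmetric diagonal)
    where
    swap : ∀ a b c → a * (b * c) ≡ b * (a * c)
    swap = solve-∀
    symmetric : ∀ y w → A x y * (A x w * A w y) ≡ A x w * (A x y * A y w)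
    symmetric y w = trans (swap (A x y) (A x w) (A w y)) (cong (λ c → A x w * (A x y * c)) (A-sym w y))
    diagonal : ∀ y → A x y * (A x y * A y y) ≡ 0
    diagonal y = trans (cong (λ c → A x y * (A x y * c)) (A-irrefl y))
                       (trans (cong (A x y *_) (*-zeroʳ (A x y))) (*-zeroʳ (A x y)))

  deg*δ≤outer+deg+inner : ∀ δ → (∀ v → δ ≤ degree G v) → ∀ x →
    deg x * δ ≤ outer x + deg x + inner x
  deg*δ≤outer+deg+inner δ minDeg x = begin
    deg x * δ
      ≡⟨ *-distribʳ-sum δ (A x) ⟩
    ∑[ y < n ] (A x y * δ)
      ≤⟨ ∑-mono-≤ (λ y → *-monoʳ-≤ (A x y) (≤-trans (subst (δ ≤_) (degree≡deg y) (minDeg y))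
                                                     (deg≤escape+1+common x y))) ⟩
    ∑[ y < n ] (A x y * (escape x y + 1 + common x y))
      ≡⟨ sum-cong-≗ (λ y → distrib (A x y) (escape x y) (common x y)) ⟩
    ∑[ y < n ] (A x y * escape x y + A x y + A x y * common x y)
      ≡⟨ trans (∑-distrib-+ (λ y → A x y * escape x y + A x y) (λ y → A x y * common x y))
               (cong (_+ inner x) (∑-distrib-+ (λ y → A x y * escape x y) (A x))) ⟩
    outer x + deg x + inner x ∎
    where
    open ≤-Reasoning
    distrib : ∀ a e c → a * (e + 1 + c) ≡ a * e + a + a * c
    distrib = solve-∀

  ball₂-size : ∀ δ → 2 ≤ δ → (∀ v → δ ≤ degree G v) → ∀ x →
    ball-bound δ ≤ ∑[ w < n ] 𝟙[ d x w <? 3 ]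
  ball₂-size δ 2≤δ minDeg x = begin
    ball-bound δ
      ≤⟨ s≤s (ball-arith δ (deg x) _ (inner x) 2≤δ (subst (δ ≤_) (degree≡deg x) (minDeg x))
                         (inner≤deg x) (inner-even x) (deg*δ≤outer+deg+inner δ minDeg x)) ⟩
    1 + deg x + outer x
      ≡⟨ ∑ball₂ x ⟨
    ∑[ w < n ] ball₂ x w
      ≤⟨ ∑-mono-≤ (ball₂≤𝟙[d<3] x) ⟩
    ∑[ w < n ] 𝟙[ d x w <? 3 ] ∎
    where open ≤-Reasoning

𝟙[<]-mono : ∀ {i K L} → K ≤ L → 𝟙[ i <? K ] ≤ 𝟙[ i <? L ]
𝟙[<]-mono {i} {K} {L} K≤L =
  ≤𝟙[] (i <? L) (𝟙[]≤1 (i <? K)) (λ pos → <-≤-trans (𝟙[]-witness (i <? K) pos) K≤L)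

-- With i = d(v, w), j = d(v, x) and e = d(x, w): if w is within distance 2 of x, then it lies in
-- the annulus j − 2 ≤ d(v, w) < j + 3.
annulus : ∀ {i j e} → j ≤ i + e → i ≤ j + e → 𝟙[ i <? j ∸ 2 ] + 𝟙[ e <? 3 ] ≤ 𝟙[ i <? 3 + j ]
annulus {i} {j} {e} j≤i+e i≤j+e with e <? 3
... | yes e<3 = subst₂ (λ a b → a + 1 ≤ b)
  (sym (𝟙[]-no (i <? j ∸ 2) (≤⇒≯ j∸2≤i))) (sym (𝟙[]-yes (i <? 3 + j) i<3+j)) ≤-refl
  where
  e≤2 : e ≤ 2
  e≤2 = s≤s⁻¹ e<3
  j∸2≤i : j ∸ 2 ≤ i
  j∸2≤i = m≤n+o⇒m∸n≤o j 2 (≤-trans j≤i+e (≤-trans (+-monoʳ-≤ i e≤2) (≤-reflexive (+-comm i 2))))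
  i<3+j : i < 3 + j
  i<3+j = s≤s (≤-trans i≤j+e (≤-trans (+-monoʳ-≤ j e≤2) (≤-reflexive (+-comm j 2))))
... | no _ = ≤-trans (≤-reflexive (+-identityʳ _)) (𝟙[<]-mono (≤-trans (m∸n≤m j 2) (m≤n+m j 3)))

suc-∸≡𝟙[<]+∸ : ∀ K i → suc K ∸ i ≡ 𝟙[ i <? suc K ] + (K ∸ i)
suc-∸≡𝟙[<]+∸ K i with i <? suc K
... | yes i<1+K = +-∸-assoc 1 (s≤s⁻¹ i<1+K)
... | no i≮1+K = trans (m≤n⇒m∸n≡0 (≮⇒≥ i≮1+K)) (sym (m≤n⇒m∸n≡0 (≤-trans (n≤1+n K) (≮⇒≥ i≮1+K))))

am-gm : ∀ x y → 2 * x * y ≤ x * x + y * y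
am-gm x y with ≤-total x y
... | inj₁ x≤y = subst (λ z → 2 * x * z ≤ x * x + z * z) (m+[n∸m]≡n x≤y)
                   (≤-trans (m≤m+n _ _) (≤-reflexive (square-gap x (y ∸ x))))
  where
  square-gap : ∀ x t → 2 * x * (x + t) + t * t ≡ x * x + (x + t) * (x + t)
  square-gap = solve-∀
... | inj₂ y≤x = subst (λ z → 2 * z * y ≤ z * z + y * y) (m+[n∸m]≡n y≤x)
                   (≤-trans (m≤m+n _ _) (≤-reflexive (square-gap y (x ∸ y))))
  where
  square-gap : ∀ y t → 2 * (y + t) * y + t * t ≡ (y + t) * (y + t) + y * y
  square-gap = solve-∀

-- Eliminating the deficit T and maximising the resulting quadratic in k (by AM-GM).
transmission-arith : ∀ a b n k T D → a + 2 * T ≤ n * k + b → D * k * (k + 1) ≤ 10 * T + 4 * D * k →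
  20 * D * a ≤ 20 * D * b + (5 * n + 3 * D) * (5 * n + 3 * D)
transmission-arith a b n k T D a≤ T≥ = +-cancelʳ-≤ (y * y) _ _ (begin
  20 * D * a + y * y            ≤⟨ +-cancelʳ-≤ W _ _ combined ⟩
  20 * D * b + 2 * x * y        ≤⟨ +-monoʳ-≤ (20 * D * b) (am-gm x y) ⟩
  20 * D * b + (x * x + y * y)  ≡⟨ +-assoc (20 * D * b) (x * x) (y * y) ⟨
  20 * D * b + x * x + y * y    ∎)
  where
  open ≤-Reasoning
  x = 5 * n + 3 * D
  y = 2 * D * k
  W = 40 * D * T + 4 * D * D * k
  combined : 20 * D * a + y * y + W ≤ 20 * D * b + 2 * x * y + W
  combined = subst₂ _≤_ (lhs a T D k) (rhs b n k T D)
    (+-mono-≤ (*-monoʳ-≤ (20 * D) a≤) (*-monoʳ-≤ (4 * D) T≥))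
    where
    lhs : ∀ a T D k → 20 * D * (a + 2 * T) + 4 * D * (D * k * (k + 1)) ≡
                      20 * D * a + 2 * D * k * (2 * D * k) + (40 * D * T + 4 * D * D * k)
    lhs = solve-∀
    rhs : ∀ b n k T D → 20 * D * (n * k + b) + 4 * D * (10 * T + 4 * D * k) ≡
                        20 * D * b + 2 * (5 * n + 3 * D) * (2 * D * k) + (40 * D * T + 4 * D * D * k)
    rhs = solve-∀

-- With n = p + 1, this is (5n + 3D)² / (20 D (n − 1)) ≤ 5(n + 1)/(4D) + 101/20.
square-arith : ∀ D p → 1 ≤ D → D ≤ suc p → 5 ≤ p →
  (5 * suc p + 3 * D) * (5 * suc p + 3 * D) ≤ 25 * p * (suc p + 1) + 101 * D * p
square-arith D@(suc D′) p@(suc (suc (suc (suc (suc p′))))) _ D≤n (s≤s (s≤s (s≤s (s≤s (s≤s _))))) = begin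
  (5 * n + 3 * D) * (5 * n + 3 * D)           ≡⟨ expand n D ⟩
  25 * n * n + 30 * D * n + 9 * D * D         ≤⟨ +-monoʳ-≤ (25 * n * n + 30 * D * n) (*-monoʳ-≤ (9 * D) D≤n) ⟩
  25 * n * n + 30 * D * n + 9 * D * n         ≤⟨ m≤m+n _ (246 + 62 * p′ + 271 * D′ + 62 * D′ * p′) ⟩
  25 * n * n + 30 * D * n + 9 * D * n + (246 + 62 * p′ + 271 * D′ + 62 * D′ * p′)
                                              ≡⟨ slack D′ p′ ⟩
  25 * p * (n + 1) + 101 * D * p              ∎
  where
  open ≤-Reasoning
  n = suc p
  expand : ∀ n D → (5 * n + 3 * D) * (5 * n + 3 * D) ≡ 25 * n * n + 30 * D * n + 9 * D * D
  expand = solve-∀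
  slack : ∀ D′ p′ → 25 * (6 + p′) * (6 + p′) + 30 * suc D′ * (6 + p′) + 9 * suc D′ * (6 + p′)
                    + (246 + 62 * p′ + 271 * D′ + 62 * D′ * p′)
                  ≡ 25 * (5 + p′) * (6 + p′ + 1) + 101 * suc D′ * (5 + p′)
  slack = solve-∀

module Layers {n} (G : Graph n) (d : Fin n → Fin n → ℕ) (isD : IsDistance G d)
  (D : ℕ) (ball-size : ∀ x → D ≤ ∑[ w < n ] 𝟙[ d x w <? 3 ]) (v : Fin n) where
  open Distance G d isD

  near : ℕ → ℕ
  near K = ∑[ w < n ] 𝟙[ d v w <? K ]

  near-step-at : ∀ x → near (d v x ∸ 2) + D ≤ near (3 + d v x)
  near-step-at x = begin
    near (d v x ∸ 2) + D
      ≤⟨ +-monoʳ-≤ _ (ball-size x) ⟩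
    near (d v x ∸ 2) + ∑[ w < n ] 𝟙[ d x w <? 3 ]
      ≡⟨ ∑-distrib-+ (λ w → 𝟙[ d v w <? d v x ∸ 2 ]) (λ w → 𝟙[ d x w <? 3 ]) ⟨
    ∑[ w < n ] (𝟙[ d v w <? d v x ∸ 2 ] + 𝟙[ d x w <? 3 ])
      ≤⟨ ∑-mono-≤ (λ w → annulus (subst (d v x ≤_) (cong (d v w +_) (d-sym w x)) (d-triangle v w x))
                                 (d-triangle v x w)) ⟩
    near (3 + d v x) ∎
    where open ≤-Reasoning

  near-step : ∀ {u} j → j ≤ d v u → near (j ∸ 2) + D ≤ near (3 + j)
  near-step {u} j j≤k with d-intermediate v u j j≤k
  ... | x , refl = near-step-at x

  near-linear-≤2 : ∀ {K} → K ≤ 2 → D * K ≤ 5 * near K + 2 * D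
  near-linear-≤2 {K} K≤2 =
    ≤-trans (*-monoʳ-≤ D K≤2) (≤-trans (≤-reflexive (*-comm D 2)) (m≤n+m (2 * D) (5 * near K)))

  near-linear-≤5 : ∀ {K} → K ≤ 5 → D ≤ near K → D * K ≤ 5 * near K + 2 * D
  near-linear-≤5 {K} K≤5 D≤near = ≤-trans (*-monoʳ-≤ D K≤5)
    (≤-trans (≤-reflexive (*-comm D 5)) (≤-trans (*-monoʳ-≤ 5 D≤near) (m≤m+n _ _)))

  near-linear : ∀ u K → K ≤ d v u → D * K ≤ 5 * near K + 2 * D
  near-linear u 0 _ = near-linear-≤2 z≤n
  near-linear u 1 _ = near-linear-≤2 (s≤s z≤n)
  near-linear u 2 _ = near-linear-≤2 (s≤s (s≤s z≤n))
  near-linear u 3 K≤ = near-linear-≤5 (s≤s (s≤s (s≤s z≤n)))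
    (≤-trans (m≤n+m D _) (near-step 0 (≤-trans z≤n K≤)))
  near-linear u 4 K≤ = near-linear-≤5 (s≤s (s≤s (s≤s (s≤s z≤n))))
    (≤-trans (m≤n+m D _) (near-step 1 (≤-trans (s≤s z≤n) K≤)))
  near-linear u (suc (suc (suc (suc (suc K))))) K≤ = begin
    D * (5 + K)                  ≡⟨ *-distribˡ-+ D 5 K ⟩
    D * 5 + D * K                ≤⟨ +-monoʳ-≤ (D * 5) (near-linear u K (≤-trans (m≤n+m K 5) K≤)) ⟩
    D * 5 + (5 * near K + 2 * D) ≡⟨ regroup D (near K) ⟩
    5 * (near K + D) + 2 * D     ≤⟨ +-monoˡ-≤ (2 * D) (*-monoʳ-≤ 5 (near-step (2 + K) (≤-trans (m≤n+m _ 3) K≤))) ⟩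
    5 * near (5 + K) + 2 * D     ∎
    where
    open ≤-Reasoning
    regroup : ∀ a b → a * 5 + (5 * b + 2 * a) ≡ 5 * (b + a) + 2 * a
    regroup = solve-∀

  deficit : ℕ → ℕ
  deficit K = ∑[ w < n ] (K ∸ d v w)

  deficit-suc : ∀ K → deficit (suc K) ≡ near (suc K) + deficit K
  deficit-suc K = trans (sum-cong-≗ (λ w → suc-∸≡𝟙[<]+∸ K (d v w)))
                        (∑-distrib-+ (λ w → 𝟙[ d v w <? suc K ]) (λ w → K ∸ d v w))

  deficit-quadratic : ∀ u K → K ≤ d v u → D * K * (K + 1) ≤ 10 * deficit K + 4 * D * K
  deficit-quadratic u zero _ = ≤-trans (≤-reflexive (cong (_* 1) (*-zeroʳ D))) z≤n
  deficit-quadratic u (suc K) K≤ = begin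
    D * suc K * (suc K + 1)
      ≡⟨ expand D K ⟩
    D * K * (K + 1) + 2 * (D * suc K)
      ≤⟨ +-mono-≤ (deficit-quadratic u K (≤-trans (n≤1+n K) K≤)) (*-monoʳ-≤ 2 (near-linear u (suc K) K≤)) ⟩
    10 * deficit K + 4 * D * K + 2 * (5 * near (suc K) + 2 * D)
      ≡⟨ regroup D K (deficit K) (near (suc K)) ⟩
    10 * (near (suc K) + deficit K) + 4 * D * suc K
      ≡⟨ cong (λ t → 10 * t + 4 * D * suc K) (deficit-suc K) ⟨
    10 * deficit (suc K) + 4 * D * suc K ∎
    where
    open ≤-Reasoning
    expand : ∀ D K → D * suc K * (suc K + 1) ≡ D * K * (K + 1) + 2 * (D * suc K)
    expand = solve-∀
    regroup : ∀ D K t l → 10 * t + 4 * D * K + 2 * (5 * l + 2 * D) ≡ 10 * (l + t) + 4 * D * suc K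
    regroup = solve-∀

  transmission≡∑ : ∀ x → transmission d x ≡ ∑[ w < n ] d x w
  transmission≡∑ x = List-sum-allFin (d x)

  transmission-deficit : ∀ u → transmission d v + 2 * deficit (d v u) ≤ n * d v u + transmission d u
  transmission-deficit u = begin
    transmission d v + 2 * deficit k
      ≡⟨ cong₂ _+_ (transmission≡∑ v) (*-distribˡ-sum 2 (λ w → k ∸ d v w)) ⟩
    ∑[ w < n ] d v w + ∑[ w < n ] (2 * (k ∸ d v w))
      ≡⟨ ∑-distrib-+ (d v) (λ w → 2 * (k ∸ d v w)) ⟨
    ∑[ w < n ] (d v w + 2 * (k ∸ d v w))
      ≤⟨ ∑-mono-≤ (λ w → pointwise (d-triangle v u w)
                           (subst (k ≤_) (cong (d v w +_) (d-sym w u)) (d-triangle v w u))) ⟩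
    ∑[ w < n ] (k + d u w)
      ≡⟨ ∑-distrib-+ (λ _ → k) (d u) ⟩
    ∑[ w < n ] k + ∑[ w < n ] d u w
      ≡⟨ cong₂ _+_ (∑-const n k) (sym (transmission≡∑ u)) ⟩
    n * k + transmission d u ∎
    where
    open ≤-Reasoning
    k = d v u
    pointwise : ∀ {i e} → i ≤ k + e → k ≤ i + e → i + 2 * (k ∸ i) ≤ k + e
    pointwise {i} {e} i≤k+e k≤i+e with ≤-total i k
    ... | inj₂ k≤i = subst (λ t → i + 2 * t ≤ k + e) (sym (m≤n⇒m∸n≡0 k≤i))
                           (subst (_≤ k + e) (sym (+-identityʳ i)) i≤k+e)
    ... | inj₁ i≤k = begin
      i + 2 * (k ∸ i)       ≡⟨ twice i (k ∸ i) ⟩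
      i + (k ∸ i) + (k ∸ i) ≡⟨ cong (_+ (k ∸ i)) (m+[n∸m]≡n i≤k) ⟩
      k + (k ∸ i)           ≤⟨ +-monoʳ-≤ k (m≤n+o⇒m∸n≤o k i k≤i+e) ⟩
      k + e                 ∎
      where
      twice : ∀ a b → a + 2 * b ≡ a + b + b
      twice = solve-∀

  transmission-gap : ∀ u →
    20 * D * transmission d v ≤ 20 * D * transmission d u + (5 * n + 3 * D) * (5 * n + 3 * D)
  transmission-gap u = transmission-arith _ _ n (d v u) (deficit (d v u)) D
    (transmission-deficit u) (deficit-quadratic u (d v u) ≤-refl)

i≤j+k⇒i-j≤k : ∀ {i j k : ℤ} → i ℤ.≤ j ℤ.+ k → i ℤ.- j ℤ.≤ k
i≤j+k⇒i-j≤k {i} {j} {k} i≤j+k = subst (i ℤ.- j ℤ.≤_) (cancel j k) (ℤP.+-monoˡ-≤ (ℤ.- j) i≤j+k)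
  where
  cancel : ∀ j k → j ℤ.+ k ℤ.- j ≡ k
  cancel = ℤSolver.solve-∀

ℚᵘ-difference-≤ : ∀ a b c r p q s →
  a * suc q * suc s ≤ b * suc q * suc s + (c * suc s + r * suc q) * suc p →
  mkℚᵘ (ℤ.+ a) p ℚᵘ.- mkℚᵘ (ℤ.+ b) p ℚᵘ.≤ mkℚᵘ (ℤ.+ c) q ℚᵘ.+ mkℚᵘ (ℤ.+ r) s
ℚᵘ-difference-≤ a b c r p q s H =
  ℚᵘ.*≤* (subst₂ ℤ._≤_ (sym lhs) (sym rhs) (i≤j+k⇒i-j≤k {j = ℤ.+ (b * P * (Q * S))}
    (subst (ℤ.+ (a * P * (Q * S)) ℤ.≤_) (ℤP.pos-+ (b * P * (Q * S)) ((c * S + r * Q) * (P * P)))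
           (ℤ.+≤+ H·P))))
  where
  P = suc p
  Q = suc q
  S = suc s
  H·P : a * P * (Q * S) ≤ b * P * (Q * S) + (c * S + r * Q) * (P * P)
  H·P = subst₂ _≤_ (reorder a P Q S) (reorder′ b c r P Q S) (*-monoʳ-≤ P H)
    where
    reorder : ∀ a P Q S → P * (a * Q * S) ≡ a * P * (Q * S)
    reorder = solve-∀
    reorder′ : ∀ b c r P Q S →
      P * (b * Q * S + (c * S + r * Q) * P) ≡ b * P * (Q * S) + (c * S + r * Q) * (P * P)
    reorder′ = solve-∀
  pos-*₃ : ∀ x y z → ℤ.+ (x * y * z) ≡ ℤ.+ x ℤ.* ℤ.+ y ℤ.* ℤ.+ z
  pos-*₃ x y z = trans (ℤP.pos-* (x * y) z) (cong (ℤ._* ℤ.+ z) (ℤP.pos-* x y))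
  lhs : (ℤ.+ a ℤ.* ℤ.+ P ℤ.+ ℤ.- (ℤ.+ b) ℤ.* ℤ.+ P) ℤ.* ℤ.+ (Q * S) ≡
        ℤ.+ (a * P * (Q * S)) ℤ.- ℤ.+ (b * P * (Q * S))
  lhs = trans (distrib (ℤ.+ a) (ℤ.+ P) (ℤ.+ b) (ℤ.+ (Q * S)))
              (sym (cong₂ ℤ._-_ (pos-*₃ a P (Q * S)) (pos-*₃ b P (Q * S))))
    where
    distrib : ∀ a p b m → (a ℤ.* p ℤ.+ ℤ.- b ℤ.* p) ℤ.* m ≡ a ℤ.* p ℤ.* m ℤ.- b ℤ.* p ℤ.* m
    distrib = ℤSolver.solve-∀
  rhs : (ℤ.+ c ℤ.* ℤ.+ S ℤ.+ ℤ.+ r ℤ.* ℤ.+ Q) ℤ.* ℤ.+ (P * P) ≡ ℤ.+ ((c * S + r * Q) * (P * P))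
  rhs = sym (trans (ℤP.pos-* (c * S + r * Q) (P * P)) (cong (ℤ._* ℤ.+ (P * P))
                   (trans (ℤP.pos-+ (c * S) (r * Q)) (cong₂ ℤ._+_ (ℤP.pos-* c S) (ℤP.pos-* r Q)))))

ℚ-difference-≤ : ∀ a b c r p q s →
  a * suc q * suc s ≤ b * suc q * suc s + (c * suc s + r * suc q) * suc p →
  (ℤ.+ a) ℚ./ suc p ℚ.- (ℤ.+ b) ℚ./ suc p ℚ.≤ (ℤ.+ c) ℚ./ suc q ℚ.+ (ℤ.+ r) ℚ./ suc s
ℚ-difference-≤ a b c r p q s H = ℚ.toℚᵘ-cancel-≤
  (ℚᵘ.≤-respʳ-≃ (ℚᵘ.≃-sym sum≃) (ℚᵘ.≤-respˡ-≃ (ℚᵘ.≃-sym difference≃) (ℚᵘ-difference-≤ a b c r p q s H)))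
  where
  X = mkℚᵘ (ℤ.+ a) p
  Y = mkℚᵘ (ℤ.+ b) p
  Z = mkℚᵘ (ℤ.+ c) q
  W = mkℚᵘ (ℤ.+ r) s
  difference≃ : ℚ.toℚᵘ (ℚ.fromℚᵘ X ℚ.- ℚ.fromℚᵘ Y) ℚᵘ.≃ X ℚᵘ.- Y
  difference≃ = ℚᵘ.≃-trans (ℚ.toℚᵘ-homo-+ (ℚ.fromℚᵘ X) (ℚ.- ℚ.fromℚᵘ Y))
    (ℚᵘ.+-cong (ℚ.toℚᵘ-fromℚᵘ X) (ℚᵘ.≃-trans (ℚ.toℚᵘ-homo‿- (ℚ.fromℚᵘ Y)) (ℚᵘ.-‿cong (ℚ.toℚᵘ-fromℚᵘ Y))))
  sum≃ : ℚ.toℚᵘ (ℚ.fromℚᵘ Z ℚ.+ ℚ.fromℚᵘ W) ℚᵘ.≃ Z ℚᵘ.+ W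
  sum≃ = ℚᵘ.≃-trans (ℚ.toℚᵘ-homo-+ (ℚ.fromℚᵘ Z) (ℚ.fromℚᵘ W)) (ℚᵘ.+-cong (ℚ.toℚᵘ-fromℚᵘ Z) (ℚ.toℚᵘ-fromℚᵘ W))

foldr-⊔-attained : ∀ {A : Set} (f : A → ℕ) (x₀ : A) xs → ∃ λ x → foldr _⊔_ 0 (map f xs) ≤ f x
foldr-⊔-attained f x₀ [] = x₀ , z≤n
foldr-⊔-attained f x₀ (y ∷ ys) with foldr-⊔-attained f x₀ ys
... | x , ≤fx with ≤-total (f y) (f x)
...   | inj₁ fy≤fx = x , ⊔-lub fy≤fx ≤fx
...   | inj₂ fx≤fy = y , ⊔-lub ≤-refl (≤-trans ≤fx fx≤fy)

foldr-⊓-attained : ∀ {A : Set} (f : A → ℕ) (x₀ : A) xs → ∃ λ x → f x ≤ foldr _⊓_ (f x₀) (map f xs)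
foldr-⊓-attained f x₀ [] = x₀ , ≤-refl
foldr-⊓-attained f x₀ (y ∷ ys) with foldr-⊓-attained f x₀ ys
... | x , fx≤ with ≤-total (f y) (f x)
...   | inj₁ fy≤fx = y , ⊓-glb ≤-refl (≤-trans fy≤fx fx≤)
...   | inj₂ fx≤fy = x , ⊓-glb fx≤fy fx≤

maxTrans-attained : ∀ {n} (d : Fin (suc n) → Fin (suc n) → ℕ) → ∃ λ v → maxTrans d ≤ transmission d v
maxTrans-attained d = foldr-⊔-attained (transmission d) zero (allFin _)

minTrans-attained : ∀ {n} (d : Fin (suc n) → Fin (suc n) → ℕ) → ∃ λ u → transmission d u ≤ minTrans d
minTrans-attained d = foldr-⊓-attained (transmission d) zero (allFin _)

bound-from-gap : ∀ m δ a b → let p = suc m ; D = ball-bound δ in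
  20 * D * a ≤ 20 * D * b + (25 * p * (suc p + 1) + 101 * D * p) →
  divByPred (suc p) a ℚ.- divByPred (suc p) b ℚ.≤ bound (suc p) δ
bound-from-gap m δ a b gap = ℚ-difference-≤ a b (5 * (suc p + 1)) 101 m _ 19
  (subst₂ _≤_ (times4 a D) (times4′ b D p) (*-monoʳ-≤ 4 gap))
  where
  p = suc m
  D = ball-bound δ
  times4 : ∀ a D → 4 * (20 * D * a) ≡ a * (4 * D) * 20
  times4 = solve-∀
  times4′ : ∀ b D p → 4 * (20 * D * b + (25 * p * (suc p + 1) + 101 * D * p)) ≡
                      b * (4 * D) * 20 + (5 * (suc p + 1) * 20 + 101 * (4 * D)) * p
  times4′ = solve-∀

theorem3p4 : (n δ : ℕ) → 3 ≤ δ → 6 ≤ n →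
    (G : Graph n) → Connected G → C4Free G → MinDegree G δ →
    (d : Fin n → Fin n → ℕ) → IsDistance G d →
    remoteness d ℚ.- proximity d ℚ.≤ bound n δ
theorem3p4 n@(suc (suc m)) δ 3≤δ (s≤s 5≤m+1) G _ c4 (minDeg , _) d isD =
  bound-from-gap m δ (maxTrans d) (minTrans d) (begin
    20 * D * maxTrans d
      ≤⟨ *-monoʳ-≤ (20 * D) (proj₂ (maxTrans-attained d)) ⟩
    20 * D * transmission d v
      ≤⟨ Layers.transmission-gap G d isD D ball-size v u ⟩
    20 * D * transmission d u + (5 * n + 3 * D) * (5 * n + 3 * D)
      ≤⟨ +-mono-≤ (*-monoʳ-≤ (20 * D) (proj₂ (minTrans-attained d)))
                  (square-arith D (suc m) (s≤s z≤n) D≤n 5≤m+1) ⟩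
    20 * D * minTrans d + (25 * suc m * (n + 1) + 101 * D * suc m) ∎)
  where
  open ≤-Reasoning
  D = ball-bound δ
  ball-size : ∀ x → D ≤ ∑[ w < n ] 𝟙[ d x w <? 3 ]
  ball-size = Ball.ball₂-size G d isD c4 δ (≤-trans (n≤1+n 2) 3≤δ) minDeg
  D≤n : D ≤ n
  D≤n = ≤-trans (ball-size zero) (∑-≤-card (λ w → 𝟙[]≤1 (d zero w <? 3)))
  v = proj₁ (maxTrans-attained d)
  u = proj₁ (minTrans-attained d)
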